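{- Let $f:\omega\to\omega$ be a bijection and let $f^*$ be its pullback. Let $S\subseteq\omega$ be an infinite computable set, and suppose that the map $f^*_S:\mathcal D_S\to\mathcal D_S$, $f^*_S([g]_S)=[f^*(g)]_S$, is (well defined and) an automorphism of $\mathcal D_S$. Then $f$ is computable.
   Context: The pullback of $f:\omega\to\omega$ is $f^*:\omega^\omega\to\omega^\omega$, $f^*(A)(n)=A(f(n))$; it maps $S^\omega$ into $S^\omega$. For $S\subseteq\omega$, $\mathcal D_S=S^\omega/\equiv_{\mathrm T}$, with elements $[g]_S=\{h\in S^\omega: h\equiv_{\mathrm T} g\}$, ordered by Turing reducibility. An automorphism of $\mathcal D_S$ is a bijection $\pi$ with $\mathbf x\le\mathbf y$ iff $\pi(\mathbf x)\le\pi(\mathbf y)$. -}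

module Defs where

open import Data.Nat using (ℕ; zero; suc; _<_; _≤_)
open import Data.Fin using (Fin)
open import Data.Vec using (Vec; []; _∷_; lookup)
open import Data.Bool using (Bool; true; false; if_then_else_)
open import Data.Product using (Σ; _×_; _,_)
open import Relation.Binary.PropositionalEquality using (_≡_)

-- Oracle (relativized) partial recursive functions, as Kleene's
-- μ-recursive functions with an extra oracle basic function.

data Code : ℕ → Set where
  zer  : ∀ {n} → Code n
  succ : Code 1
  proj : ∀ {n} → Fin n → Code n
  orc  : Code 1
  comp : ∀ {m n} → Code m → Vec (Code n) m → Code n
  prec : ∀ {n} → Code n → Code (suc (suc n)) → Code (suc n)
  mu   : ∀ {n} → Code (suc n) → Code n

mutual
  data Eval (A : ℕ → ℕ) : ∀ {n} → Code n → Vec ℕ n → ℕ → Set where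
    ev-zer  : ∀ {n} {xs : Vec ℕ n} → Eval A zer xs 0
    ev-succ : ∀ {x} → Eval A succ (x ∷ []) (suc x)
    ev-proj : ∀ {n} {xs : Vec ℕ n} (i : Fin n) → Eval A (proj i) xs (lookup xs i)
    ev-orc  : ∀ {x} → Eval A orc (x ∷ []) (A x)
    ev-comp : ∀ {m n} {f : Code m} {gs : Vec (Code n) m} {xs : Vec ℕ n} {ys : Vec ℕ m} {y : ℕ} →
              EvalV A gs xs ys → Eval A f ys y → Eval A (comp f gs) xs y
    ev-prec-z : ∀ {n} {b : Code n} {s : Code (suc (suc n))} {xs : Vec ℕ n} {y : ℕ} →
              Eval A b xs y → Eval A (prec b s) (0 ∷ xs) y
    ev-prec-s : ∀ {n} {b : Code n} {s : Code (suc (suc n))} {xs : Vec ℕ n} {k r y : ℕ} →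
              Eval A (prec b s) (k ∷ xs) r → Eval A s (k ∷ r ∷ xs) y →
              Eval A (prec b s) (suc k ∷ xs) y
    ev-mu   : ∀ {n} {c : Code (suc n)} {xs : Vec ℕ n} {k : ℕ} →
              Eval A c (k ∷ xs) 0 →
              (∀ j → j < k → Σ ℕ λ m → Eval A c (j ∷ xs) (suc m)) →
              Eval A (mu c) xs k

  data EvalV (A : ℕ → ℕ) {n : ℕ} : ∀ {m} → Vec (Code n) m → Vec ℕ n → Vec ℕ m → Set where
    evV-[] : ∀ {xs} → EvalV A [] xs []
    evV-∷  : ∀ {m} {g : Code n} {gs : Vec (Code n) m} {xs : Vec ℕ n} {y : ℕ} {ys : Vec ℕ m} →
             Eval A g xs y → EvalV A gs xs ys → EvalV A (g ∷ gs) xs (y ∷ ys)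

_≤T_ : (ℕ → ℕ) → (ℕ → ℕ) → Set
g ≤T h = Σ (Code 1) λ c → ∀ x → Eval h c (x ∷ []) (g x)

_≡T_ : (ℕ → ℕ) → (ℕ → ℕ) → Set
g ≡T h = (g ≤T h) × (h ≤T g)

-- computable = computable with no oracle information (the constant-0 oracle)
Computable : (ℕ → ℕ) → Set
Computable g = Σ (Code 1) λ c → ∀ x → Eval (λ _ → 0) c (x ∷ []) (g x)

_∈ₛ_ : ℕ → (ℕ → Bool) → Set
m ∈ₛ S = S m ≡ true

ComputableSet : (ℕ → Bool) → Set
ComputableSet S = Computable (λ n → if S n then 1 else 0)

Infinite : (ℕ → Bool) → Set
Infinite S = ∀ n → Σ ℕ λ m → (n ≤ m) × (m ∈ₛ S)

InSω : (ℕ → Bool) → (ℕ → ℕ) → Set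
InSω S g = ∀ n → g n ∈ₛ S

pullback : (ℕ → ℕ) → (ℕ → ℕ) → (ℕ → ℕ)
pullback f A n = A (f n)

-- "f*_S : D_S → D_S, [g]_S ↦ [f*(g)]_S is well defined and an automorphism
-- of D_S", expressed on representatives g ∈ S^ω (D_S = S^ω / ≡T).

record InducesAutomorphism (S : ℕ → Bool) (f : ℕ → ℕ) : Set where
  field
    maps-into    : ∀ g → InSω S g → InSω S (pullback f g)
    well-defined : ∀ g h → InSω S g → InSω S h →
                   g ≡T h → pullback f g ≡T pullback f h
    injective    : ∀ g h → InSω S g → InSω S h →
                   pullback f g ≡T pullback f h → g ≡T h
    surjective   : ∀ h → InSω S h →
                   Σ (ℕ → ℕ) λ g → InSω S g × (pullback f g ≡T h)
    order-iff    : ∀ g h → InSω S g → InSω S h →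
                   (g ≤T h → pullback f g ≤T pullback f h) ×
                   (pullback f g ≤T pullback f h → g ≤T h)

module Submission where

-- Let e be the increasing enumeration
-- of the infinite computable set S and let c be the constant function with
-- some value s₀ ∈ S.  Both lie in S^ω, and e ≤T c because e is computable.
-- Hence f*(e) = e ∘ f ≤T f*(c) = c; as c is computable, e ∘ f is computable.
-- Finally f(n) is recovered from e(f(n)) by searching for the unique k with
-- e(k) = e(f(n)), since e is computable and injective.

open import Defs
open import Data.Nat using (ℕ; zero; suc; _+_; _∸_; _<_; _≤_; pred)
open import Data.Nat.Properties
  using ( ≤-refl; ≤-antisym; <-trans; <-irrefl; <-cmp; m<1+n⇒m<n∨m≡n
        ; m+n≡0⇒m≡0; m+n≡0⇒n≡0; n∸n≡0; m∸n≡0⇒m≤n; m≤n⇒m∸n≡0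
        ; pred[m∸n]≡m∸[1+n]; _≟_ )
open import Data.Bool using (Bool; true; false; if_then_else_)
open import Data.Fin using () renaming (zero to fz; suc to fs)
open import Data.Vec using (Vec; []; _∷_)
open import Data.Product using (Σ; _×_; _,_; proj₁; proj₂)
open import Data.Sum using (_⊎_; inj₁; inj₂)
open import Data.Empty using (⊥-elim)
open import Relation.Nullary using (¬_; yes; no)
open import Relation.Unary using (Decidable)
open import Relation.Binary using (tri<; tri≈; tri>)
open import Relation.Binary.PropositionalEquality using (_≡_; _≢_; refl; sym)
open import Function.Definitions using (Bijective)

eval-≡ : ∀ {A n} {c : Code n} {xs y y'} → y ≡ y' → Eval A c xs y → Eval A c xs y'
eval-≡ refl ev = ev

mutual
  relativize : ∀ {n} → Code 1 → Code n → Code n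
  relativize k zer         = zer
  relativize k succ        = succ
  relativize k (proj i)    = proj i
  relativize k orc         = k
  relativize k (comp f gs) = comp (relativize k f) (relativizeV k gs)
  relativize k (prec b s)  = prec (relativize k b) (relativize k s)
  relativize k (mu c)      = mu (relativize k c)

  relativizeV : ∀ {n m} → Code 1 → Vec (Code n) m → Vec (Code n) m
  relativizeV k []       = []
  relativizeV k (g ∷ gs) = relativize k g ∷ relativizeV k gs

module Relativization (A B : ℕ → ℕ) (k : Code 1)
                      (k-computes-A : ∀ x → Eval B k (x ∷ []) (A x)) where
  mutual
    relativize-sound : ∀ {n} {c : Code n} {xs y} →
                       Eval A c xs y → Eval B (relativize k c) xs y
    relativize-sound ev-zer            = ev-zer
    relativize-sound ev-succ           = ev-succ
    relativize-sound (ev-proj i)       = ev-proj i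
    relativize-sound (ev-orc {x})      = k-computes-A x
    relativize-sound (ev-comp vs ev)   = ev-comp (relativize-soundV vs) (relativize-sound ev)
    relativize-sound (ev-prec-z ev)    = ev-prec-z (relativize-sound ev)
    relativize-sound (ev-prec-s ev ev') = ev-prec-s (relativize-sound ev) (relativize-sound ev')
    relativize-sound (ev-mu ev below)  = ev-mu (relativize-sound ev) (relativize-below below)

    relativize-below : ∀ {n} {c : Code (suc n)} {xs : Vec ℕ n} {k' : ℕ} →
      (∀ j → j < k' → Σ ℕ λ m → Eval A c (j ∷ xs) (suc m)) →
      (∀ j → j < k' → Σ ℕ λ m → Eval B (relativize k c) (j ∷ xs) (suc m))
    relativize-below below j j<k' with below j j<k'
    ... | m , ev = m , relativize-sound ev

    relativize-soundV : ∀ {n m} {gs : Vec (Code n) m} {xs ys} →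
                        EvalV A gs xs ys → EvalV B (relativizeV k gs) xs ys
    relativize-soundV evV-[]       = evV-[]
    relativize-soundV (evV-∷ ev vs) = evV-∷ (relativize-sound ev) (relativize-soundV vs)

zeroOracle : ℕ → ℕ
zeroOracle _ = 0

computable⇒≤T : ∀ {g} → Computable g → ∀ h → g ≤T h
computable⇒≤T (c , hc) h =
  relativize zer c , λ x → Relativization.relativize-sound zeroOracle h zer (λ _ → ev-zer) (hc x)

≤T-computable : ∀ {g h} → g ≤T h → Computable h → Computable g
≤T-computable (c , hc) (k , hk) =
  relativize k c , λ x → Relativization.relativize-sound _ zeroOracle k hk (hc x)

_·_ : ∀ {n} → Code 1 → Code n → Code n
c · g = comp c (g ∷ [])

·-eval : ∀ {A n} {c : Code 1} {g : Code n} {xs a y} →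
         Eval A g xs a → Eval A c (a ∷ []) y → Eval A (c · g) xs y
·-eval evg evc = ev-comp (evV-∷ evg evV-[]) evc

app₂ : ∀ {n} → Code 2 → Code n → Code n → Code n
app₂ c g h = comp c (g ∷ h ∷ [])

app₂-eval : ∀ {A n} {c : Code 2} {g h : Code n} {xs a b y} →
            Eval A g xs a → Eval A h xs b → Eval A c (a ∷ b ∷ []) y →
            Eval A (app₂ c g h) xs y
app₂-eval evg evh evc = ev-comp (evV-∷ evg (evV-∷ evh evV-[])) evc

constC : ∀ {n} → ℕ → Code n
constC zero    = zer
constC (suc k) = succ · constC k

constC-eval : ∀ {A n} {xs : Vec ℕ n} k → Eval A (constC k) xs k
constC-eval zero    = ev-zer
constC-eval (suc k) = ·-eval (constC-eval k) ev-succ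

const-computable : ∀ s → Computable (λ _ → s)
const-computable s = constC s , λ _ → constC-eval s

predC : Code 1
predC = prec zer (proj fz)

predC-eval : ∀ {A} n → Eval A predC (n ∷ []) (pred n)
predC-eval zero    = ev-prec-z ev-zer
predC-eval (suc n) = ev-prec-s (predC-eval n) (ev-proj fz)

monusC : Code 2
monusC = prec (proj fz) (predC · proj (fs fz))

monusC-eval : ∀ {A} k x → Eval A monusC (k ∷ x ∷ []) (x ∸ k)
monusC-eval zero    x = ev-prec-z (ev-proj fz)
monusC-eval (suc k) x = eval-≡ (pred[m∸n]≡m∸[1+n] x k)
  (ev-prec-s (monusC-eval k x) (·-eval (ev-proj (fs fz)) (predC-eval (x ∸ k))))

addC : Code 2
addC = prec (proj fz) (succ · proj (fs fz))

addC-eval : ∀ {A} a b → Eval A addC (a ∷ b ∷ []) (a + b)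
addC-eval zero    b = ev-prec-z (ev-proj fz)
addC-eval (suc a) b = ev-prec-s (addC-eval a b) (·-eval (ev-proj (fs fz)) ev-succ)

_⊖_ : ∀ {n} → Code n → Code n → Code n
g ⊖ h = app₂ monusC h g

⊖-eval : ∀ {A n} {g h : Code n} {xs a b} →
         Eval A g xs a → Eval A h xs b → Eval A (g ⊖ h) xs (a ∸ b)
⊖-eval {a = a} {b} evg evh = app₂-eval evh evg (monusC-eval b a)

_⊕_ : ∀ {n} → Code n → Code n → Code n
g ⊕ h = app₂ addC g h

⊕-eval : ∀ {A n} {g h : Code n} {xs a b} →
         Eval A g xs a → Eval A h xs b → Eval A (g ⊕ h) xs (a + b)
⊕-eval {a = a} {b} evg evh = app₂-eval evg evh (addC-eval a b)

distance : ℕ → ℕ → ℕ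
distance a b = (a ∸ b) + (b ∸ a)

distance-self : ∀ a → distance a a ≡ 0
distance-self a rewrite n∸n≡0 a = refl

distance≡0⇒≡ : ∀ a b → distance a b ≡ 0 → a ≡ b
distance≡0⇒≡ a b d≡0 = ≤-antisym (m∸n≡0⇒m≤n (m+n≡0⇒m≡0 (a ∸ b) d≡0))
                                 (m∸n≡0⇒m≤n (m+n≡0⇒n≡0 (a ∸ b) d≡0))

LeastZero : (ℕ → ℕ) → ℕ → Set
LeastZero F k = (F k ≡ 0) × (∀ j → j < k → F j ≢ 0)

least-witness : ∀ {P : ℕ → Set} → Decidable P → ∀ {m} → P m →
                Σ ℕ λ k → P k × (∀ j → j < k → ¬ P j)
least-witness {P} P? {m} Pm with below (suc m)
  where
  below : ∀ n → (∀ j → j < n → ¬ P j) ⊎ (Σ ℕ λ k → P k × (∀ j → j < k → ¬ P j))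
  below zero = inj₁ λ _ ()
  below (suc n) with below n | P? n
  ... | inj₂ found | _      = inj₂ found
  ... | inj₁ none  | yes Pn = inj₂ (n , Pn , none)
  ... | inj₁ none  | no ¬Pn = inj₁ λ j j<1+n → case (m<1+n⇒m<n∨m≡n j<1+n)
    where
    case : ∀ {j} → j < n ⊎ j ≡ n → ¬ P j
    case {j} (inj₁ j<n)  = none j j<n
    case     (inj₂ refl) = ¬Pn
... | inj₂ found = found
... | inj₁ none  = ⊥-elim (none m ≤-refl Pm)

least-zero : ∀ (F : ℕ → ℕ) {m} → F m ≡ 0 → Σ ℕ (LeastZero F)
least-zero F = least-witness (λ k → F k ≟ 0)

nonzero-pred : ∀ n → n ≢ 0 → Σ ℕ λ m → n ≡ suc m
nonzero-pred zero    n≢0 = ⊥-elim (n≢0 refl)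
nonzero-pred (suc n) _   = n , refl

mu-eval : ∀ {A n} {c : Code (suc n)} {xs : Vec ℕ n} (F : ℕ → ℕ) →
          (∀ k → Eval A c (k ∷ xs) (F k)) → ∀ {k} → LeastZero F k →
          Eval A (mu c) xs k
mu-eval F evF {k} (Fk≡0 , below) = ev-mu (eval-≡ Fk≡0 (evF k)) λ j j<k →
  let (m , Fj≡1+m) = nonzero-pred (F j) (below j j<k)
  in m , eval-≡ Fj≡1+m (evF j)

-- If e is computable and injective and e ∘ f is computable, so is f:
-- f(n) is the least (indeed the only) k with e(k) = e(f(n)).
injective-inverse : ∀ {e f : ℕ → ℕ} → Computable e → (∀ {j k} → e j ≡ e k → j ≡ k) →
                    Computable (λ n → e (f n)) → Computable f
injective-inverse {e} {f} (E , evE) e-inj (H , evH) =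
  mu search , λ n → mu-eval (gap n) (search-eval n) (gap-least n)
  where
  search : Code 2
  search = ((E · proj fz) ⊖ (H · proj (fs fz))) ⊕ ((H · proj (fs fz)) ⊖ (E · proj fz))

  gap : ℕ → ℕ → ℕ
  gap n k = distance (e k) (e (f n))

  search-eval : ∀ n k → Eval zeroOracle search (k ∷ n ∷ []) (gap n k)
  search-eval n k = ⊕-eval (⊖-eval ek efn) (⊖-eval efn ek)
    where
    ek  = ·-eval (ev-proj fz) (evE k)
    efn = ·-eval (ev-proj (fs fz)) (evH n)

  gap-least : ∀ n → LeastZero (gap n) (f n)
  gap-least n = distance-self (e (f n)) , λ j j<fn gap≡0 →
    <-irrefl (e-inj (distance≡0⇒≡ (e j) (e (f n)) gap≡0)) j<fn

increasing⇒monotone : ∀ (e : ℕ → ℕ) → (∀ n → e n < e (suc n)) →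
                      ∀ {a b} → a < b → e a < e b
increasing⇒monotone e step {a} {suc b} a<1+b with m<1+n⇒m<n∨m≡n a<1+b
... | inj₁ a<b  = <-trans (increasing⇒monotone e step a<b) (step b)
... | inj₂ refl = step a

increasing⇒injective : ∀ (e : ℕ → ℕ) → (∀ n → e n < e (suc n)) →
                       ∀ {j k} → e j ≡ e k → j ≡ k
increasing⇒injective e step {j} {k} ej≡ek with <-cmp j k
... | tri< j<k _ _ = ⊥-elim (<-irrefl ej≡ek (increasing⇒monotone e step j<k))
... | tri≈ _ j≡k _ = j≡k
... | tri> _ _ k<j = ⊥-elim (<-irrefl (sym ej≡ek) (increasing⇒monotone e step k<j))

module Enumeration (S : ℕ → Bool) (S-computable : ComputableSet S) (S-infinite : Infinite S) where

  χ : ℕ → ℕ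
  χ m = if S m then 1 else 0

  χC : Code 1
  χC = proj₁ S-computable

  χC-eval : ∀ m → Eval zeroOracle χC (m ∷ []) (χ m)
  χC-eval = proj₂ S-computable

  gapToS : ℕ → ℕ → ℕ
  gapToS x m = (x ∸ m) + (1 ∸ χ m)

  gapToS≡0⇒ : ∀ x m → gapToS x m ≡ 0 → (x ≤ m) × (m ∈ₛ S)
  gapToS≡0⇒ x m gap≡0 with S m
  ... | true  = m∸n≡0⇒m≤n (m+n≡0⇒m≡0 (x ∸ m) gap≡0) , refl
  ... | false with m+n≡0⇒n≡0 (x ∸ m) gap≡0
  ...   | ()

  ⇒gapToS≡0 : ∀ x m → x ≤ m → m ∈ₛ S → gapToS x m ≡ 0
  ⇒gapToS≡0 x m x≤m m∈S rewrite m∈S | m≤n⇒m∸n≡0 x≤m = refl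

  gapToSC : Code 2
  gapToSC = (proj (fs fz) ⊖ proj fz) ⊕ (constC 1 ⊖ (χC · proj fz))

  gapToSC-eval : ∀ x m → Eval zeroOracle gapToSC (m ∷ x ∷ []) (gapToS x m)
  gapToSC-eval x m = ⊕-eval (⊖-eval (ev-proj (fs fz)) (ev-proj fz))
                            (⊖-eval (constC-eval 1) (·-eval (ev-proj fz) (χC-eval m)))

  next-least : ∀ x → Σ ℕ (LeastZero (gapToS x))
  next-least x = let (m , x≤m , m∈S) = S-infinite x
                 in least-zero (gapToS x) (⇒gapToS≡0 x m x≤m m∈S)

  next : ℕ → ℕ
  next x = proj₁ (next-least x)

  next-spec : ∀ x → (x ≤ next x) × (next x ∈ₛ S)
  next-spec x = gapToS≡0⇒ x (next x) (proj₁ (proj₂ (next-least x)))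

  nextC-eval : ∀ x → Eval zeroOracle (mu gapToSC) (x ∷ []) (next x)
  nextC-eval x = mu-eval (gapToS x) (gapToSC-eval x) (proj₂ (next-least x))

  enum : ℕ → ℕ
  enum zero    = next 0
  enum (suc n) = next (suc (enum n))

  enum-computable : Computable enum
  enum-computable = enumC , enumC-eval
    where
    enumC : Code 1
    enumC = prec (mu gapToSC · zer) (mu gapToSC · (succ · proj (fs fz)))

    enumC-eval : ∀ n → Eval zeroOracle enumC (n ∷ []) (enum n)
    enumC-eval zero    = ev-prec-z (·-eval ev-zer (nextC-eval 0))
    enumC-eval (suc n) = ev-prec-s (enumC-eval n)
      (·-eval (·-eval (ev-proj (fs fz)) ev-succ) (nextC-eval (suc (enum n))))

  enum-in-S : InSω S enum
  enum-in-S zero    = proj₂ (next-spec 0)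
  enum-in-S (suc n) = proj₂ (next-spec (suc (enum n)))

  enum-injective : ∀ {j k} → enum j ≡ enum k → j ≡ k
  enum-injective = increasing⇒injective enum λ n → proj₁ (next-spec (suc (enum n)))

theorem2p4 : (f : ℕ → ℕ) → Bijective _≡_ _≡_ f →
    (S : ℕ → Bool) → ComputableSet S → Infinite S →
    InducesAutomorphism S f →
    Computable f
theorem2p4 f _ S S-computable S-infinite aut =
  injective-inverse enum-computable enum-injective enum∘f-computable
  where
  open Enumeration S S-computable S-infinite

  s₀ : ℕ
  s₀ = proj₁ (S-infinite 0)

  constant-in-S : InSω S (λ _ → s₀)
  constant-in-S _ = proj₂ (proj₂ (S-infinite 0))

  enum∘f≤T-constant : pullback f enum ≤T pullback f (λ _ → s₀)
  enum∘f≤T-constant = proj₁ (InducesAutomorphism.order-iff aut enum (λ _ → s₀) enum-in-S constant-in-S)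
                            (computable⇒≤T enum-computable (λ _ → s₀))

  enum∘f-computable : Computable (λ n → enum (f n))
  enum∘f-computable = ≤T-computable enum∘f≤T-constant (const-computable s₀)
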